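{- For each positive integer $k$, there is a connected chordal graph $F_k$ such that $\mathrm{mp}(F_k)=3k$ and $\gamma_b(F_k)=4k$.
   Context: All graphs are finite, simple and undirected. A graph is chordal if every cycle on at least four vertices has a chord. For a connected graph $G=(V,E)$, $d(u,v)$ is the shortest-path distance, $\mathrm{diam}(G)$ the diameter, $N_r[v]=\{u\in V: d(u,v)\le r\}$. A broadcast is a function $f:V\to\{0,1,\dots,\mathrm{diam}(G)\}$; it is dominating if for every $u\in V$ there is $v$ with $f(v)>0$ and $d(u,v)\le f(v)$; its cost is $\sum_v f(v)$; $\gamma_b(G)$ is the minimum cost of a dominating broadcast. A multipacking is a set $M\subseteq V$ with $|N_r[v]\cap M|\le r$ for all $v\in V$ and all integers $r\ge1$; $\mathrm{mp}(G)$ is the maximum size of a multipacking. -}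

module Defs where

open import Data.Nat using (ℕ; zero; suc; _+_; _≤_; _<_)
open import Data.Bool using (Bool; true; false; _∧_; _∨_; T; if_then_else_)
open import Data.Fin using (Fin; toℕ; _≟_)
open import Data.Fin.Subset using (Subset; _∩_; ∣_∣)
open import Data.Vec using (tabulate)
open import Data.List using (map; allFin)
open import Data.Nat.ListAction using (sum)
open import Data.Product using (Σ; ∃; _×_; _,_)
open import Data.Sum using (_⊎_)
open import Relation.Binary.PropositionalEquality using (_≡_; _≢_)
open import Relation.Nullary.Decidable using (⌊_⌋)
open import Function.Definitions using (Injective)

record Graph : Set where
  field
    n       : ℕ
    adj     : Fin n → Fin n → Bool
    symm    : ∀ u v → adj u v ≡ adj v u
    irrefl  : ∀ v → adj v v ≡ false

module _ (G : Graph) where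
  open Graph G

  Adj : Fin n → Fin n → Set
  Adj u v = T (adj u v)

  anyV : (Fin n → Bool) → Bool
  anyV p = Data.List.foldr (λ w b → p w ∨ b) false (allFin n)

  -- reach u v r = true  iff  there is a walk from u to v of length ≤ r,
  -- i.e. iff d(u,v) ≤ r.
  reach : Fin n → Fin n → ℕ → Bool
  reach u v zero    = ⌊ u ≟ v ⌋
  reach u v (suc r) = reach u v r ∨ anyV (λ w → adj u w ∧ reach w v r)

  DistLe : Fin n → Fin n → ℕ → Set
  DistLe u v r = T (reach u v r)

  Connected : Set
  Connected = ∀ u v → ∃ λ r → DistLe u v r

  Consec : (m : ℕ) → Fin m → Fin m → Set
  Consec m i j = (suc (toℕ i) ≡ toℕ j) ⊎ ((suc (toℕ i) ≡ m) × (toℕ j ≡ 0))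

  IsCycle : (m : ℕ) → (Fin m → Fin n) → Set
  IsCycle m c = Injective _≡_ _≡_ c × (∀ i j → Consec m i j → Adj (c i) (c j))

  HasChord : (m : ℕ) → (Fin m → Fin n) → Set
  HasChord m c = ∃ λ i → ∃ λ j →
    i ≢ j × (¬C (Consec m i j)) × (¬C (Consec m j i)) × Adj (c i) (c j)
    where
      open import Relation.Nullary using () renaming (¬_ to ¬C)

  Chordal : Set
  Chordal = ∀ m → 4 ≤ m → (c : Fin m → Fin n) → IsCycle m c → HasChord m c

  IsDiam : ℕ → Set
  IsDiam D = (∀ u v → DistLe u v D) × (∀ D' → (∀ u v → DistLe u v D') → D ≤ D')

  IsBroadcast : (Fin n → ℕ) → Set
  IsBroadcast f = ∀ D → IsDiam D → ∀ v → f v ≤ D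

  IsDominating : (Fin n → ℕ) → Set
  IsDominating f = ∀ u → ∃ λ v → (0 < f v) × DistLe u v (f v)

  cost : (Fin n → ℕ) → ℕ
  cost f = sum (map f (allFin n))

  IsDomBroadcast : (Fin n → ℕ) → Set
  IsDomBroadcast f = IsBroadcast f × IsDominating f

  BroadcastDomNumber : ℕ → Set
  BroadcastDomNumber b =
    (∃ λ f → IsDomBroadcast f × cost f ≡ b) ×
    (∀ f → IsDomBroadcast f → b ≤ cost f)

  ball : Fin n → ℕ → Subset n
  ball v r = tabulate (λ u → reach u v r)

  IsMultipacking : Subset n → Set
  IsMultipacking M = ∀ v r → 1 ≤ r → ∣ ball v r ∩ M ∣ ≤ r

  MultipackingNumber : ℕ → Set
  MultipackingNumber p =
    (∃ λ M → IsMultipacking M × ∣ M ∣ ≡ p) ×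
    (∀ M → IsMultipacking M → ∣ M ∣ ≤ p)

{-# OPTIONS --safe #-}
-- F_k is a chain of 3k copies of the 3-sun (a triangle A B C with an ear on each side), the ear Y of
-- each sun joined to the ear X of the next. Listing the vertices sun by sun is a perfect elimination
-- order, so F_k is chordal. Any two vertices of a sun have a common closed neighbour, so a
-- multipacking meets every sun at most once, and the third ears Z form a multipacking of size 3k.
-- Broadcasting 4 from the middle sun of each block of three suns dominates F_k at cost 4k.
-- Conversely, weights 1/3 on X and Y and 2/3 on Z form a fractional multipacking of value 4k: every
-- ball of radius r ≥ 1 has weight at most r, since crossing a sun takes 3 steps and adds weight at
-- most 4/3 on either side of the centre. The balls of a dominating broadcast cover this weight with
-- total radius equal to its cost, so every dominating broadcast costs at least 4k.
module Submission where

open import Defs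
open import Data.Bool using (Bool; true; false; _∧_; _∨_; T; if_then_else_)
open import Data.Bool.Properties using (T-∧; T-∨; T-≡; ∨-comm)
open import Data.Empty using (⊥-elim)
open import Data.Fin as Fin
  using ( Fin; zero; suc; toℕ; _≟_; fromℕ; fromℕ<; inject₁; _↑ˡ_; _↑ʳ_; combine; quotient; remainder
        ; punchIn; punchOut)
open import Data.Fin.Properties
  using ( all?; any?; suc-injective; toℕ-injective; toℕ<n; toℕ-fromℕ; toℕ-fromℕ<; fromℕ<-toℕ; toℕ-inject₁
        ; punchIn-punchOut; toℕ-combine; remQuot-combine; combine-remQuot; combine-injectiveʳ)
open import Data.Fin.Subset using (Subset; _∩_; ∣_∣)
open import Data.List using (_∷_; foldr; allFin)
import Data.List as List
open import Data.List.Extrema.Nat using (argmax; f[xs]≤f[argmax])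
open import Data.List.Membership.Propositional using (_∈_)
open import Data.List.Membership.Propositional.Properties using (∈-allFin)
open import Data.List.Properties using (map-tabulate)
import Data.List.Relation.Unary.All as All
open import Data.List.Relation.Unary.Any using (here; there)
open import Data.Nat using (ℕ; zero; suc; _+_; _*_; _≤_; _<_; _<ᵇ_; _≤ᵇ_; _≡ᵇ_; z≤n; s≤s)
open import Data.Nat.ListAction using () renaming (sum to sumˡ)
import Data.Nat.Properties as ℕₚ
open ℕₚ
  using ( ≤-refl; ≤-reflexive; ≤-trans; ≤-antisym; <-irrefl; <-asym; ≮⇒≥; ≤∧≢⇒<; n≤1+n; m≤m+n
        ; m≤n+m; +-comm; +-assoc; +-suc; +-identityʳ; *-comm; *-identityʳ; *-zeroʳ; +-mono-≤; +-monoˡ-≤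
        ; +-monoʳ-≤; +-monoʳ-<; +-cancelˡ-<; <⇒<ᵇ; ≤⇒≤ᵇ; ≡ᵇ⇒≡; ≡⇒≡ᵇ; module ≤-Reasoning)
open import Algebra.Properties.Semiring.Sum ℕₚ.+-*-semiring
  using (sum; sum-syntax; sum-cong-≗; sum-remove; sum-replicate-zero; ∑-comm; *-distribˡ-sum)
open import Data.Nat.Tactic.RingSolver using (solve-∀)
open import Data.Product using (∃; _×_; _,_; proj₁; proj₂)
open import Data.Sum using (_⊎_; inj₁; inj₂)
open import Data.Unit using (tt)
open import Data.Vec using ([]; _∷_; lookup; tabulate)
open import Data.Vec.Properties using (lookup∘tabulate)
open import Function using (_∘_; id)
open import Function.Bundles using (Equivalence)
open import Function.Definitions using (Injective)
open import Relation.Binary.PropositionalEquality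
open import Relation.Nullary using (¬_; yes; no; contradiction)
open import Relation.Nullary.Decidable
  using (⌊_⌋; T?; toWitness; fromWitness; from-yes; ¬?; _×-dec_; _⊎-dec_; _→-dec_)

module _ {A : Set} (p : A → Bool) where

  T-foldr-∨⁺ : ∀ {w xs} → w ∈ xs → T (p w) → T (foldr (λ x b → p x ∨ b) false xs)
  T-foldr-∨⁺ {xs = x ∷ _} (here refl)  pw = Equivalence.from T-∨ (inj₁ pw)
  T-foldr-∨⁺ {xs = x ∷ _} (there w∈xs) pw = Equivalence.from T-∨ (inj₂ (T-foldr-∨⁺ w∈xs pw))

  T-foldr-∨⁻ : ∀ xs → T (foldr (λ x b → p x ∨ b) false xs) → ∃ λ w → T (p w)
  T-foldr-∨⁻ (x ∷ xs) h with Equivalence.to T-∨ h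
  ... | inj₁ px = x , px
  ... | inj₂ h′ = T-foldr-∨⁻ xs h′

module Walks (G : Graph) where
  open Graph G using (n; symm)

  infixr 5 _∷_

  -- Walk u v r: a walk from u to v of length at most r.
  data Walk : Fin n → Fin n → ℕ → Set where
    []  : ∀ {v r} → Walk v v r
    _∷_ : ∀ {u w v r} → Adj G u w → Walk w v r → Walk u v (suc r)

  adj-sym : ∀ {u w} → Adj G u w → Adj G w u
  adj-sym {u} {w} = subst T (symm u w)

  edge : ∀ {u v} → Adj G u v → Walk u v 1
  edge e = e ∷ []

  walk-mono : ∀ {u v r s} → r ≤ s → Walk u v r → Walk u v s
  walk-mono _         []      = []
  walk-mono (s≤s r≤s) (e ∷ p) = e ∷ walk-mono r≤s p

  _++_ : ∀ {u w v a b} → Walk u w a → Walk w v b → Walk u v (a + b)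
  _++_ {a = a} [] q = walk-mono (m≤n+m _ a) q
  (e ∷ p) ++ q      = e ∷ (p ++ q)

  _∷ʳ_ : ∀ {u w v r} → Walk u w r → Adj G w v → Walk u v (suc r)
  []      ∷ʳ e = e ∷ []
  (f ∷ p) ∷ʳ e = f ∷ (p ∷ʳ e)

  reverse : ∀ {u v r} → Walk u v r → Walk v u r
  reverse []      = []
  reverse (e ∷ p) = reverse p ∷ʳ adj-sym e

  lipschitz⇒walk≥ : (ψ : Fin n → ℕ) → (∀ {a b} → Adj G a b → ψ a ≤ suc (ψ b)) →
                    ∀ {u v r} → Walk u v r → ψ u ≤ r + ψ v
  lipschitz⇒walk≥ ψ lip {r = r} [] = m≤n+m _ r
  lipschitz⇒walk≥ ψ lip (e ∷ p)    = ≤-trans (lip e) (s≤s (lipschitz⇒walk≥ ψ lip p))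

  walk⇒dist : ∀ {u v r} → Walk u v r → DistLe G u v r
  walk⇒dist {v = v} {r} [] = self r
    where
      self : ∀ r → DistLe G v v r
      self zero    = fromWitness refl
      self (suc r) = Equivalence.from T-∨ (inj₁ (self r))
  walk⇒dist (_∷_ {w = w} e p) =
    Equivalence.from T-∨ (inj₂ (T-foldr-∨⁺ _ (∈-allFin w) (Equivalence.from T-∧ (e , walk⇒dist p))))

  reachable : ∀ {u v r} → Walk u v r → ∃ λ r → DistLe G u v r
  reachable {r = r} p = r , walk⇒dist p

  dist⇒walk : ∀ u v r → DistLe G u v r → Walk u v r
  dist⇒walk u v zero d with toWitness d
  ... | refl = []
  dist⇒walk u v (suc r) d with Equivalence.to T-∨ d
  ... | inj₁ d′ = walk-mono (n≤1+n r) (dist⇒walk u v r d′)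
  ... | inj₂ d′ with T-foldr-∨⁻ _ (allFin n) d′
  ...   | w , h with Equivalence.to T-∧ h
  ...     | e , d″ = e ∷ dist⇒walk w v r d″

∑-mono-≤ : ∀ {n} {f g : Fin n → ℕ} → (∀ i → f i ≤ g i) → sum f ≤ sum g
∑-mono-≤ {zero}  f≤g = z≤n
∑-mono-≤ {suc n} f≤g = +-mono-≤ (f≤g zero) (∑-mono-≤ (f≤g ∘ suc))

≤-∑ : ∀ {n} (f : Fin n → ℕ) i → f i ≤ sum f
≤-∑ {suc n} f i = subst (f i ≤_) (sym (sum-remove f)) (m≤m+n (f i) _)

∑-pair : ∀ {n} (f : Fin n → ℕ) {i j} → i ≢ j → f i + f j ≤ sum f
∑-pair {suc n} f {i} {j} i≢j = begin
  f i + f j                           ≡⟨ cong (λ k → f i + f k) (sym (punchIn-punchOut i≢j)) ⟩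
  f i + f (punchIn i (punchOut i≢j))  ≤⟨ +-monoʳ-≤ (f i) (≤-∑ (f ∘ punchIn i) (punchOut i≢j)) ⟩
  f i + sum (f ∘ punchIn i)           ≡⟨ sym (sum-remove f) ⟩
  sum f                               ∎
  where open ≤-Reasoning

∑-const : ∀ n c → ∑[ i < n ] c ≡ n * c
∑-const zero    c = refl
∑-const (suc n) c = cong (c +_) (∑-const n c)

∑-↑ : ∀ a b (f : Fin (a + b) → ℕ) → sum f ≡ ∑[ i < a ] f (i ↑ˡ b) + ∑[ j < b ] f (a ↑ʳ j)
∑-↑ zero    b f = refl
∑-↑ (suc a) b f = trans (cong (f zero +_) (∑-↑ a b (f ∘ suc))) (sym (+-assoc (f zero) _ _))

∑-combine : ∀ m n (f : Fin (m * n) → ℕ) → sum f ≡ ∑[ i < m ] (∑[ j < n ] f (combine i j))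
∑-combine zero    n f = refl
∑-combine (suc m) n f =
  trans (∑-↑ n (m * n) f) (cong (sum (f ∘ (_↑ˡ m * n)) +_) (∑-combine m n (f ∘ (n ↑ʳ_))))

∑-toℕ-last : ∀ n (g : ℕ → ℕ) → ∑[ i < suc n ] g (toℕ i) ≡ ∑[ i < n ] g (toℕ i) + g n
∑-toℕ-last zero    g = +-comm (g 0) 0
∑-toℕ-last (suc n) g = trans (cong (g 0 +_) (∑-toℕ-last n (g ∘ suc))) (sym (+-assoc (g 0) _ _))

sum-tabulate : ∀ {n} (f : Fin n → ℕ) → sumˡ (List.tabulate f) ≡ sum f
sum-tabulate {zero}  f = refl
sum-tabulate {suc n} f = cong (f zero +_) (sum-tabulate (f ∘ suc))

indicator : Bool → ℕ
indicator true  = 1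
indicator false = 0

∑-indicator≤1 : ∀ {n} (b : Fin n → Bool) → (∀ {i j} → T (b i) → T (b j) → i ≡ j) →
                ∑[ i < n ] indicator (b i) ≤ 1
∑-indicator≤1 {zero}  b unique = z≤n
∑-indicator≤1 {suc n} b unique with b zero in b₀
... | true  = ≤-reflexive (cong suc (trans (sum-cong-≗ rest-empty) (sum-replicate-zero n)))
  where
    rest-empty : ∀ i → indicator (b (suc i)) ≡ 0
    rest-empty i with b (suc i) in bᵢ
    ... | false = refl
    ... | true with unique (subst T (sym bᵢ) tt) (subst T (sym b₀) tt)
    ...   | ()
... | false = ∑-indicator≤1 (b ∘ suc) (λ bᵢ bⱼ → suc-injective (unique bᵢ bⱼ))

∣∣≡∑ : ∀ {n} (p : Subset n) → ∣ p ∣ ≡ ∑[ i < n ] indicator (lookup p i)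
∣∣≡∑ []          = refl
∣∣≡∑ (true ∷ p)  = cong suc (∣∣≡∑ p)
∣∣≡∑ (false ∷ p) = ∣∣≡∑ p

∣tabulate∩∣≡∑ : ∀ {n} (b : Fin n → Bool) (p : Subset n) →
                ∣ tabulate b ∩ p ∣ ≡ ∑[ i < n ] (if b i then indicator (lookup p i) else 0)
∣tabulate∩∣≡∑ b [] = refl
∣tabulate∩∣≡∑ b (x ∷ p) with b zero
... | false = ∣tabulate∩∣≡∑ (b ∘ suc) p
... | true with x
...   | true  = cong suc (∣tabulate∩∣≡∑ (b ∘ suc) p)
...   | false = ∣tabulate∩∣≡∑ (b ∘ suc) p

≤-if : ∀ {b} x → T b → x ≤ (if b then x else 0)
≤-if {true} x _ = ≤-refl

-- Balls, broadcasts and multipackings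

module Balls (G : Graph) where
  open Graph G using (n)
  open Walks G

  ballWeight : (Fin n → ℕ) → Fin n → ℕ → ℕ
  ballWeight w v r = ∑[ u < n ] (if reach G u v r then w u else 0)

  ∣ball∩∣≡ballWeight : ∀ (M : Subset n) v r →
                       ∣ ball G v r ∩ M ∣ ≡ ballWeight (indicator ∘ lookup M) v r
  ∣ball∩∣≡ballWeight M v r = ∣tabulate∩∣≡∑ (λ u → reach G u v r) M

  cost≡∑ : ∀ f → cost G f ≡ sum f
  cost≡∑ f = trans (cong sumˡ (map-tabulate id f)) (sum-tabulate f)

  -- Weak duality: the hypothesis says that w / c is a fractional multipacking.
  dominating-cost-bound : (w : Fin n → ℕ) (c : ℕ) → (∀ v r → 1 ≤ r → ballWeight w v r ≤ c * r) →
                          ∀ f → IsDominating G f → sum w ≤ c * cost G f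
  dominating-cost-bound w c ball-bound f dominating = begin
    sum w                                  ≤⟨ ∑-mono-≤ covered ⟩
    ∑[ u < n ] (∑[ v < n ] coverage v u)   ≡⟨ ∑-comm (λ u v → coverage v u) ⟩
    ∑[ v < n ] (∑[ u < n ] coverage v u)   ≤⟨ ∑-mono-≤ charge ⟩
    ∑[ v < n ] (c * f v)                   ≡⟨ sym (*-distribˡ-sum c f) ⟩
    c * sum f                              ≡⟨ cong (c *_) (sym (cost≡∑ f)) ⟩
    c * cost G f                           ∎
    where
      open ≤-Reasoning
      coverage : Fin n → Fin n → ℕ
      coverage v u = if (0 <ᵇ f v) ∧ reach G u v (f v) then w u else 0

      covered : ∀ u → w u ≤ ∑[ v < n ] coverage v u
      covered u with dominating u
      ... | v , 0<fv , d =
        ≤-trans (≤-if (w u) (Equivalence.from T-∧ (<⇒<ᵇ 0<fv , d))) (≤-∑ (λ v → coverage v u) v)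

      charge : ∀ v → ∑[ u < n ] coverage v u ≤ c * f v
      charge v with f v
      ... | zero  = ≤-reflexive (trans (sum-replicate-zero n) (sym (*-zeroʳ c)))
      ... | suc r = ball-bound v (suc r) (s≤s z≤n)

  multipacking-unique : ∀ {M} → IsMultipacking G M → ∀ {u u′ c} → Walk u c 1 → Walk u′ c 1 →
                        T (lookup M u) → T (lookup M u′) → u ≡ u′
  multipacking-unique {M} packing {u} {u′} {c} p p′ Mu Mu′ with u ≟ u′
  ... | yes u≡u′ = u≡u′
  ... | no  u≢u′ = contradiction (≤-trans two (packing c 1 ≤-refl)) (<-irrefl refl)
    where
      term : Fin n → ℕ
      term x = if reach G x c 1 then indicator (lookup M x) else 0
      one : ∀ {x} → Walk x c 1 → T (lookup M x) → 1 ≤ term x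
      one {x} q Mx with reach G x c 1 | walk⇒dist q | lookup M x
      ... | true | _ | true = ≤-refl
      two : 2 ≤ ∣ ball G c 1 ∩ M ∣
      two = ≤-trans (+-mono-≤ (one p Mu) (one p′ Mu′))
              (≤-trans (∑-pair term u≢u′) (≤-reflexive (sym (∣ball∩∣≡ballWeight M c 1))))

-- Chordality from an elimination order

argmax-Fin : ∀ {m} (f : Fin (suc m) → ℕ) → ∃ λ t → ∀ i → f i ≤ f t
argmax-Fin f = argmax f zero (allFin _) , λ i → All.lookup (f[xs]≤f[argmax] {f = f} zero (allFin _)) (∈-allFin i)

module Cycles (G : Graph) where

  Succ : ℕ → ℕ → ℕ → Set
  Succ m a b = (suc a ≡ b) ⊎ ((suc a ≡ m) × (b ≡ 0))

  predecessor : ∀ {m} (t : Fin m) → ∃ λ p → Consec G m p t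
  predecessor {suc m} zero    = fromℕ m , inj₂ (cong suc (toℕ-fromℕ m) , refl)
  predecessor {suc m} (suc t) = inject₁ t , inj₁ (cong suc (toℕ-inject₁ t))

  successor : ∀ {m} (t : Fin m) → ∃ λ s → Consec G m t s
  successor {suc m} t with suc (toℕ t) ℕₚ.<? suc m
  ... | yes t+1<m = fromℕ< t+1<m , inj₁ (sym (toℕ-fromℕ< t+1<m))
  ... | no  t+1≮m = zero , inj₂ (≤-antisym (toℕ<n t) (≮⇒≥ t+1≮m) , refl)

  succ⇒≢ : ∀ {m a b} → 2 ≤ m → Succ m a b → a ≢ b
  succ⇒≢ _             (inj₁ ())           refl
  succ⇒≢ (s≤s (s≤s _)) (inj₂ (refl , refl)) ()

  succ-path : ∀ {m a b c} → 4 ≤ m → Succ m a b → Succ m b c → a ≢ c × ¬ Succ m a c × ¬ Succ m c a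
  succ-path (s≤s (s≤s (s≤s (s≤s _)))) (inj₁ refl) (inj₁ refl) =
    (λ ()) , (λ { (inj₁ ()) ; (inj₂ (_ , ())) }) , (λ { (inj₁ ()) ; (inj₂ (e , refl)) → contradiction e λ () })
  succ-path (s≤s (s≤s (s≤s (s≤s _)))) (inj₁ refl) (inj₂ (refl , refl)) =
    (λ ()) , (λ { (inj₁ ()) ; (inj₂ (() , _)) }) , (λ { (inj₁ ()) ; (inj₂ (() , _)) })
  succ-path (s≤s (s≤s (s≤s (s≤s _)))) (inj₂ (refl , refl)) (inj₁ refl) =
    (λ ()) , (λ { (inj₁ ()) ; (inj₂ (_ , ())) }) , (λ { (inj₁ ()) ; (inj₂ (() , _)) })
  succ-path (s≤s (s≤s (s≤s (s≤s _)))) (inj₂ (refl , refl)) (inj₂ (() , _))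

  module _ (ρ : Fin (Graph.n G) → ℕ) (ρ-injective : Injective _≡_ _≡_ ρ)
           (eliminate : ∀ {p q r} → Adj G p q → Adj G p r → ρ q < ρ p → ρ r < ρ p → q ≢ r → Adj G q r)
           where
    open Walks G using (adj-sym)

    elimination⇒chordal : Chordal G
    elimination⇒chordal (suc m) 4≤m c (c-injective , c-adj) with argmax-Fin (ρ ∘ c)
    ... | t , maximal with predecessor t | successor t
    ...   | p , p→t | s , t→s with succ-path 4≤m p→t t→s
    ...     | p≢s , ¬p→s , ¬s→p =
      p , s , p≢s ∘ cong toℕ , ¬p→s , ¬s→p ,
      eliminate (adj-sym (c-adj p t p→t)) (c-adj t s t→s)
                (below (succ⇒≢ 2≤m p→t ∘ cong toℕ)) (below (succ⇒≢ 2≤m t→s ∘ cong toℕ ∘ sym))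
                (p≢s ∘ cong toℕ ∘ c-injective)
      where
        2≤m : 2 ≤ suc m
        2≤m = ≤-trans (s≤s (s≤s z≤n)) 4≤m
        below : ∀ {i} → i ≢ t → ρ (c i) < ρ (c t)
        below i≢t = ≤∧≢⇒< (maximal _) (i≢t ∘ c-injective ∘ ρ-injective)

-- A 3-sun: the triangle A B C with ears X on A B, Y on B C and Z on A C.
-- Its vertices are numbered X A B C Y Z, an elimination order of the sun.
pattern X = zero
pattern A = suc zero
pattern B = suc (suc zero)
pattern C = suc (suc (suc zero))
pattern Y = suc (suc (suc (suc zero)))
pattern Z = suc (suc (suc (suc (suc zero))))

sunEdge : Fin 6 → Fin 6 → Bool
sunEdge X A = true
sunEdge X B = true
sunEdge A B = true
sunEdge A C = true
sunEdge A Z = true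
sunEdge B C = true
sunEdge B Y = true
sunEdge C Y = true
sunEdge C Z = true
sunEdge _ _ = false

sunAdj : Fin 6 → Fin 6 → Bool
sunAdj s t = sunEdge s t ∨ sunEdge t s

sunDist : Fin 6 → Fin 6 → ℕ
sunDist s t = if ⌊ s ≟ t ⌋ then 0 else if sunAdj s t then 1 else 2

sunDist-self : ∀ s → sunDist s s ≡ 0
sunDist-self = from-yes (all? λ s → sunDist s s ℕₚ.≟ 0)

sunDist≤2 : ∀ s t → sunDist s t ≤ 2
sunDist≤2 = from-yes (all? λ s → all? λ t → sunDist s t ℕₚ.≤? 2)

sunDist-lipschitz : ∀ s s′ u → T (sunAdj s s′) → sunDist s u ≤ suc (sunDist s′ u)
sunDist-lipschitz = from-yes (all? λ s → all? λ s′ → all? λ u →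
  T? (sunAdj s s′) →-dec sunDist s u ℕₚ.≤? suc (sunDist s′ u))

sun-elimination : ∀ p q r → T (sunAdj p q) → T (sunAdj p r) → q Fin.< p → r Fin.< p → q ≢ r →
                  T (sunAdj q r)
sun-elimination = from-yes (all? λ p → all? λ q → all? λ r →
  T? (sunAdj p q) →-dec T? (sunAdj p r) →-dec q Fin.<? p →-dec r Fin.<? p →-dec ¬? (q ≟ r) →-dec
  T? (sunAdj q r))

sun-centre : ∀ s t → ∃ λ c → (s ≡ c ⊎ T (sunAdj s c)) × (t ≡ c ⊎ T (sunAdj t c))
sun-centre = from-yes (all? λ s → all? λ t → any? λ c →
  (s ≟ c ⊎-dec T? (sunAdj s c)) ×-dec (t ≟ c ⊎-dec T? (sunAdj t c)))

-- Chains of 3-suns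

≡ᵇ-sym : ∀ i j → (i ≡ᵇ j) ≡ (j ≡ᵇ i)
≡ᵇ-sym zero    zero    = refl
≡ᵇ-sym zero    (suc j) = refl
≡ᵇ-sym (suc i) zero    = refl
≡ᵇ-sym (suc i) (suc j) = ≡ᵇ-sym i j

linkAdj : ℕ → Fin 6 → ℕ → Fin 6 → Bool
linkAdj i s j t = ⌊ s ≟ Y ⌋ ∧ (⌊ t ≟ X ⌋ ∧ (suc i ≡ᵇ j))

chainAdj : ℕ → Fin 6 → ℕ → Fin 6 → Bool
chainAdj i s j t = (sunAdj s t ∧ (i ≡ᵇ j)) ∨ (linkAdj i s j t ∨ linkAdj j t i s)

chainAdj-sym : ∀ i s j t → chainAdj i s j t ≡ chainAdj j t i s
chainAdj-sym i s j t =
  cong₂ _∨_ (cong₂ _∧_ (∨-comm (sunEdge s t) (sunEdge t s)) (≡ᵇ-sym i j)) (∨-comm (linkAdj i s j t) _)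

chainAdj-irrefl : ∀ i s → chainAdj i s i s ≡ false
chainAdj-irrefl i X = refl
chainAdj-irrefl i A = refl
chainAdj-irrefl i B = refl
chainAdj-irrefl i C = refl
chainAdj-irrefl i Y = refl
chainAdj-irrefl i Z = refl

data ChainEdge : ℕ → Fin 6 → ℕ → Fin 6 → Set where
  inSun     : ∀ {i s t} → T (sunAdj s t) → ChainEdge i s i t
  rightLink : ∀ {i} → ChainEdge i Y (suc i) X
  leftLink  : ∀ {i} → ChainEdge (suc i) X i Y

linkAdj⇒ : ∀ i s j t → T (linkAdj i s j t) → s ≡ Y × t ≡ X × suc i ≡ j
linkAdj⇒ i s j t h with s ≟ Y | t ≟ X
... | yes refl | yes refl = refl , refl , ≡ᵇ⇒≡ (suc i) j h
... | yes _    | no _     = ⊥-elim h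
... | no _     | _        = ⊥-elim h

chainAdj⇒edge : ∀ {i s j t} → T (chainAdj i s j t) → ChainEdge i s j t
chainAdj⇒edge {i} {s} {j} {t} e with Equivalence.to (T-∨ {sunAdj s t ∧ (i ≡ᵇ j)}) e
... | inj₁ same with Equivalence.to (T-∧ {sunAdj s t}) same
...   | st , i≡j = subst (λ j → ChainEdge i s j t) (≡ᵇ⇒≡ i j i≡j) (inSun st)
chainAdj⇒edge {i} {s} {j} {t} e | inj₂ links with Equivalence.to (T-∨ {linkAdj i s j t}) links
... | inj₁ link with linkAdj⇒ i s j t link
...   | refl , refl , refl = rightLink
chainAdj⇒edge {i} {s} {j} {t} e | inj₂ links | inj₂ link with linkAdj⇒ j t i s link
...   | refl , refl , refl = leftLink

edge⇒chainAdj : ∀ {i s j t} → ChainEdge i s j t → T (chainAdj i s j t)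
edge⇒chainAdj {i} {s} {t = t} (inSun st) =
  Equivalence.from (T-∨ {sunAdj s t ∧ (i ≡ᵇ i)})
    (inj₁ (Equivalence.from (T-∧ {sunAdj s t}) (st , ≡⇒≡ᵇ i i refl)))
edge⇒chainAdj {i} rightLink = Equivalence.from (T-∨ {i ≡ᵇ i}) (inj₁ (≡⇒≡ᵇ i i refl))
edge⇒chainAdj {suc i} leftLink = ≡⇒≡ᵇ i i refl

-- Vertex s of sun j is combine j s.
sunIndex : ∀ m → Fin (m * 6) → ℕ
sunIndex m u = toℕ (quotient {m} 6 u)

kind : ∀ m → Fin (m * 6) → Fin 6
kind m = remainder {m} 6

sunChain : ℕ → Graph
sunChain m = record
  { n      = m * 6
  ; adj    = λ u v → chainAdj (sunIndex m u) (kind m u) (sunIndex m v) (kind m v)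
  ; symm   = λ u v → chainAdj-sym (sunIndex m u) (kind m u) (sunIndex m v) (kind m v)
  ; irrefl = λ v → chainAdj-irrefl (sunIndex m v) (kind m v)
  }

next-sun-later : ∀ i (s t : Fin 6) → 6 * i + toℕ s < 6 * suc i + toℕ t
next-sun-later i s t = begin-strict
  6 * i + toℕ s   <⟨ +-monoʳ-< (6 * i) (toℕ<n s) ⟩
  6 * i + 6       ≡⟨ trans (+-comm (6 * i) 6) (sym (ℕₚ.*-suc 6 i)) ⟩
  6 * suc i       ≤⟨ m≤m+n (6 * suc i) (toℕ t) ⟩
  6 * suc i + toℕ t ∎
  where open ≤-Reasoning

chainEdge-elimination : ∀ {i s j t k u} → ChainEdge i s j t → ChainEdge i s k u →
  6 * j + toℕ t < 6 * i + toℕ s → 6 * k + toℕ u < 6 * i + toℕ s → (j ≡ k → t ≢ u) → ChainEdge j t k u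
chainEdge-elimination {i} {s} {t = t} {u = u} (inSun st) (inSun su) t<s u<s t≢u =
  inSun (sun-elimination s t u st su (+-cancelˡ-< (6 * i) _ _ t<s) (+-cancelˡ-< (6 * i) _ _ u<s) (t≢u refl))
chainEdge-elimination {i} (inSun _) rightLink _ X<Y = contradiction X<Y (<-asym (next-sun-later i Y X))
chainEdge-elimination {i} rightLink _ X<Y _         = contradiction X<Y (<-asym (next-sun-later i Y X))
chainEdge-elimination {suc i} {u = u} leftLink (inSun _) _ u<X =
  contradiction (+-cancelˡ-< (6 * suc i) (toℕ u) 0 u<X) λ ()
chainEdge-elimination {suc i} {t = t} (inSun _) leftLink t<X _ =
  contradiction (+-cancelˡ-< (6 * suc i) (toℕ t) 0 t<X) λ ()
chainEdge-elimination leftLink leftLink _ _ Y≢Y = contradiction refl (Y≢Y refl)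

-- The distance from vertex s of sun i to vertex t of sun j: a walk between different suns leaves and
-- enters them through the linking ears and spends 3 steps on every sun strictly in between.
chainDist : ℕ → Fin 6 → ℕ → Fin 6 → ℕ
chainDist zero    s zero    t = sunDist s t
chainDist zero    s (suc j) t = j * 3 + (sunDist s Y + suc (sunDist X t))
chainDist (suc i) s zero    t = i * 3 + (sunDist s X + suc (sunDist Y t))
chainDist (suc i) s (suc j) t = chainDist i s j t

chainDist-self : ∀ i t → chainDist i t i t ≡ 0
chainDist-self zero    t = sunDist-self t
chainDist-self (suc i) t = chainDist-self i t

private
  +-suc² : ∀ x y → x + suc (suc y) ≡ suc (suc (x + y))
  +-suc² x y = trans (+-suc x (suc y)) (cong suc (+-suc x y))

  shifted : ∀ a {x y} b → x ≤ suc y → a + (x + b) ≤ suc (a + (y + b))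
  shifted a b x≤y+1 = ≤-trans (+-monoʳ-≤ a (+-monoˡ-≤ b x≤y+1)) (≤-reflexive (+-suc a _))

chainDist-lipschitz : ∀ {i s i′ s′} j t → ChainEdge i s i′ s′ →
                      chainDist i s j t ≤ suc (chainDist i′ s′ j t)
chainDist-lipschitz {zero}  {s} {s′ = s′} zero    t (inSun ss′) = sunDist-lipschitz s s′ t ss′
chainDist-lipschitz {zero}  {s} {s′ = s′} (suc j) t (inSun ss′) = shifted (j * 3) _ (sunDist-lipschitz s s′ Y ss′)
chainDist-lipschitz {suc i} {s} {s′ = s′} zero    t (inSun ss′) = shifted (i * 3) _ (sunDist-lipschitz s s′ X ss′)
chainDist-lipschitz {suc i}               (suc j) t (inSun ss′) = chainDist-lipschitz j t (inSun {i} ss′)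
chainDist-lipschitz {zero}  zero          t rightLink = m≤n+m _ 2
chainDist-lipschitz {zero}  (suc zero)    t rightLink = ≤-refl
chainDist-lipschitz {zero}  (suc (suc j)) t rightLink = ≤-reflexive (cong suc (sym (+-suc² (j * 3) _)))
chainDist-lipschitz {suc i} zero          t rightLink = ≤-trans (≤-reflexive (+-suc² (i * 3) _)) (m≤n+m _ 2)
chainDist-lipschitz {suc i} (suc j)       t rightLink = chainDist-lipschitz j t (rightLink {i})
chainDist-lipschitz {suc zero}    zero          t leftLink = ≤-refl
chainDist-lipschitz {suc zero}    (suc zero)    t leftLink = m≤n+m _ 2
chainDist-lipschitz {suc zero}    (suc (suc j)) t leftLink = ≤-trans (≤-reflexive (+-suc² (j * 3) _)) (m≤n+m _ 2)
chainDist-lipschitz {suc (suc i)} zero          t leftLink = ≤-reflexive (cong suc (sym (+-suc² (i * 3) _)))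
chainDist-lipschitz {suc (suc i)} (suc j)       t leftLink = chainDist-lipschitz j t (leftLink {i})

-- Weights of balls in a chain of suns

weightWithin : (Fin 6 → ℕ) → (Fin 6 → ℕ) → ℕ → ℕ
weightWithin W Q r = ∑[ s < 6 ] (if Q s ≤ᵇ r then W s else 0)

-- Q is the distance profile of the sun as seen from the centre of the ball; suns further out along
-- a ray are 3 steps further away.
rayWeight : (Fin 6 → ℕ) → (Fin 6 → ℕ) → ℕ → ℕ
rayWeight W Q (suc (suc (suc q))) = weightWithin W Q (3 + q) + rayWeight W Q q
rayWeight W Q r                   = weightWithin W Q r

≤ᵇ-suc : ∀ a q → (suc a ≤ᵇ suc q) ≡ (a ≤ᵇ q)
≤ᵇ-suc zero    q = refl
≤ᵇ-suc (suc a) q = refl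

weightWithin-shift : ∀ W Q q → weightWithin W (λ s → 3 + Q s) (3 + q) ≡ weightWithin W Q q
weightWithin-shift W Q q = sum-cong-≗ λ s → cong (λ b → if b then W s else 0)
  (trans (≤ᵇ-suc (2 + Q s) (2 + q)) (trans (≤ᵇ-suc (1 + Q s) (1 + q)) (≤ᵇ-suc (Q s) q)))

weightWithin-full : ∀ W Q r → (∀ s → Q s ≤ r) → weightWithin W Q r ≡ sum W
weightWithin-full W Q r Q≤r =
  sum-cong-≗ λ s → cong (λ b → if b then W s else 0) (Equivalence.to T-≡ (≤⇒≤ᵇ (Q≤r s)))

private
  +-∑-zero : ∀ x K → x + ∑[ d < K ] 0 ≡ x
  +-∑-zero x K = trans (cong (x +_) (sum-replicate-zero K)) (+-identityʳ x)

ray-bound : ∀ W Q K r → ∑[ d < K ] weightWithin W (λ s → toℕ d * 3 + Q s) r ≤ rayWeight W Q r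
ray-bound W Q zero    r                   = z≤n
ray-bound W Q (suc K) (suc (suc (suc q))) =
  +-monoʳ-≤ (weightWithin W Q (3 + q))
    (≤-trans (≤-reflexive (sum-cong-≗ {K} λ d → weightWithin-shift W (λ s → toℕ d * 3 + Q s) q))
             (ray-bound W Q K q))
ray-bound W Q (suc K) 0 = ≤-reflexive (+-∑-zero (weightWithin W Q 0) K)
ray-bound W Q (suc K) 1 = ≤-reflexive (+-∑-zero (weightWithin W Q 1) K)
ray-bound W Q (suc K) 2 = ≤-reflexive (+-∑-zero (weightWithin W Q 2) K)

private
  within-5 : ∀ {a b q} → a ≤ 2 → b ≤ 2 → 2 ≤ q → a + suc b ≤ 3 + q
  within-5 a≤2 b≤2 2≤q = ≤-trans (+-mono-≤ a≤2 (s≤s b≤2)) (+-monoʳ-≤ 3 2≤q)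

  sunDist≤ : ∀ {r} s t → 2 ≤ r → sunDist s t ≤ r
  sunDist≤ s t 2≤r = ≤-trans (sunDist≤2 s t) 2≤r

  two-more-suns : ∀ a x y → (a + x) + (a + (a + y)) ≡ 2 * a + (x + (a + y))
  two-more-suns = solve-∀

module _ (W : Fin 6 → ℕ) (t : Fin 6) where

  leftProfile rightProfile : Fin 6 → ℕ
  leftProfile  s = sunDist s Y + suc (sunDist X t)
  rightProfile s = sunDist s X + suc (sunDist Y t)

  leftSun : ℕ → ℕ → ℕ
  leftSun r d = weightWithin W (λ s → d * 3 + leftProfile s) r

  notLeft : ℕ → ℕ
  notLeft r = weightWithin W (λ s → sunDist s t) r + rayWeight W rightProfile r

  -- Bounds the weight of every ball centred at a vertex of kind t, whatever the length of the chain.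
  ballWeightBound : ℕ → ℕ
  ballWeightBound r = rayWeight W leftProfile r + notLeft r

  suns-bound : ∀ r m i → ∑[ j < m ] weightWithin W (λ s → chainDist (toℕ j) s i t) r ≤
                         ∑[ d < i ] leftSun r (toℕ d) + notLeft r
  suns-bound r zero    i       = z≤n
  suns-bound r (suc m) zero    = +-monoʳ-≤ _ (ray-bound W rightProfile m r)
  suns-bound r (suc m) (suc i) = begin
    leftSun r i + ∑[ j < m ] weightWithin W (λ s → chainDist (toℕ j) s i t) r
      ≤⟨ +-monoʳ-≤ (leftSun r i) (suns-bound r m i) ⟩
    leftSun r i + (left + notLeft r)      ≡⟨ sym (+-assoc (leftSun r i) left (notLeft r)) ⟩
    (leftSun r i + left) + notLeft r      ≡⟨ cong (_+ notLeft r) (+-comm (leftSun r i) left) ⟩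
    (left + leftSun r i) + notLeft r      ≡⟨ cong (_+ notLeft r) (sym (∑-toℕ-last i (leftSun r))) ⟩
    ∑[ d < suc i ] leftSun r (toℕ d) + notLeft r ∎
    where
      open ≤-Reasoning
      left = ∑[ d < i ] leftSun r (toℕ d)

  ballWeightBound-step : ∀ q → 2 ≤ q → ballWeightBound (3 + q) ≡ 2 * sum W + ballWeightBound q
  ballWeightBound-step q 2≤q
    rewrite weightWithin-full W leftProfile (3 + q) (λ s → within-5 (sunDist≤2 s Y) (sunDist≤2 X t) 2≤q)
          | weightWithin-full W rightProfile (3 + q) (λ s → within-5 (sunDist≤2 s X) (sunDist≤2 Y t) 2≤q)
          | weightWithin-full W (λ s → sunDist s t) (3 + q) (λ s → sunDist≤ s t (≤-trans 2≤q (m≤n+m q 3)))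
          | weightWithin-full W (λ s → sunDist s t) q (λ s → sunDist≤ s t 2≤q)
    = two-more-suns (sum W) (rayWeight W leftProfile q) (rayWeight W rightProfile q)

-- Past radius 4, growing the radius by 3 adds at most one full sun on either side.
ballWeightBound-linear : ∀ W c → (∀ t (r : Fin 4) → ballWeightBound W t (suc (toℕ r)) ≤ c * suc (toℕ r)) →
                         2 * sum W ≤ 3 * c → ∀ t r → 1 ≤ r → ballWeightBound W t r ≤ c * r
ballWeightBound-linear W c small per-sun t 1 _ = small t zero
ballWeightBound-linear W c small per-sun t 2 _ = small t (suc zero)
ballWeightBound-linear W c small per-sun t 3 _ = small t (suc (suc zero))
ballWeightBound-linear W c small per-sun t 4 _ = small t (suc (suc (suc zero)))
ballWeightBound-linear W c small per-sun t (suc (suc (suc q@(suc (suc _))))) _ = begin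
  ballWeightBound W t (3 + q)        ≡⟨ ballWeightBound-step W t q (s≤s (s≤s z≤n)) ⟩
  2 * sum W + ballWeightBound W t q  ≤⟨ +-mono-≤ per-sun (ballWeightBound-linear W c small per-sun t q (s≤s z≤n)) ⟩
  3 * c + c * q                      ≡⟨ distribute c q ⟩
  c * (3 + q)                        ∎
  where
    open ≤-Reasoning
    distribute : ∀ c q → 3 * c + c * q ≡ c * (3 + q)
    distribute = solve-∀

zWeight : Fin 6 → ℕ
zWeight s = indicator ⌊ s ≟ Z ⌋

-- Three times a fractional multipacking of value 4/3 per sun.
dualWeight : Fin 6 → ℕ
dualWeight X = 1
dualWeight Y = 1
dualWeight Z = 2
dualWeight _ = 0

module SunChain (m : ℕ) where
  open Walks (sunChain m) public
  open Balls (sunChain m) public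

  sunIndex-combine : ∀ (j : Fin m) s → sunIndex m (combine j s) ≡ toℕ j
  sunIndex-combine j s = cong (toℕ ∘ proj₁) (remQuot-combine j s)

  kind-combine : ∀ (j : Fin m) s → kind m (combine j s) ≡ s
  kind-combine j s = cong proj₂ (remQuot-combine j s)

  position : ∀ u → toℕ u ≡ 6 * sunIndex m u + toℕ (kind m u)
  position u = trans (cong toℕ (sym (combine-remQuot {m} 6 u))) (toℕ-combine (quotient {m} 6 u) (kind m u))

  same-vertex : ∀ {u v} → sunIndex m u ≡ sunIndex m v → kind m u ≡ kind m v → u ≡ v
  same-vertex {u} {v} i≡j s≡t = begin
    u                                      ≡⟨ sym (combine-remQuot {m} 6 u) ⟩
    combine (quotient {m} 6 u) (kind m u)  ≡⟨ cong₂ combine (toℕ-injective i≡j) s≡t ⟩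
    combine (quotient {m} 6 v) (kind m v)  ≡⟨ combine-remQuot {m} 6 v ⟩
    v                                      ∎
    where open ≡-Reasoning

  adj⇒edge : ∀ u v → Adj (sunChain m) u v → ChainEdge (sunIndex m u) (kind m u) (sunIndex m v) (kind m v)
  adj⇒edge u v = chainAdj⇒edge

  edge⇒adj : ∀ (i j : Fin m) {s t} → ChainEdge (toℕ i) s (toℕ j) t → Adj (sunChain m) (combine i s) (combine j t)
  edge⇒adj i j {s} {t} e =
    subst T (sym (cong₂ (λ (a , b) (c , d) → chainAdj (toℕ a) b (toℕ c) d)
                        (remQuot-combine i s) (remQuot-combine j t)))
            (edge⇒chainAdj e)

  chordal : Chordal (sunChain m)
  chordal = Cycles.elimination⇒chordal (sunChain m) toℕ toℕ-injective eliminate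
    where
      eliminate : ∀ {p q r} → Adj (sunChain m) p q → Adj (sunChain m) p r → toℕ q < toℕ p → toℕ r < toℕ p →
                  q ≢ r → Adj (sunChain m) q r
      eliminate {p} {q} {r} pq pr q<p r<p q≢r =
        edge⇒chainAdj (chainEdge-elimination (adj⇒edge p q pq) (adj⇒edge p r pr)
                        (subst₂ _<_ (position q) (position p) q<p) (subst₂ _<_ (position r) (position p) r<p)
                        (λ i≡j s≡t → q≢r (same-vertex i≡j s≡t)))

  walk≥chainDist : ∀ {u v r} → Walk u v r → chainDist (sunIndex m u) (kind m u) (sunIndex m v) (kind m v) ≤ r
  walk≥chainDist {u} {v} {r} p =
    subst (ψ u ≤_) (trans (cong (r +_) (chainDist-self (sunIndex m v) (kind m v))) (+-identityʳ r))
      (lipschitz⇒walk≥ ψ (λ {a} {b} e → chainDist-lipschitz _ _ (adj⇒edge a b e)) p)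
    where
      ψ : Fin (m * 6) → ℕ
      ψ w = chainDist (sunIndex m w) (kind m w) (sunIndex m v) (kind m v)

  close⇒walk : ∀ j {s c} → s ≡ c ⊎ T (sunAdj s c) → Walk (combine j s) (combine j c) 1
  close⇒walk j (inj₁ refl) = []
  close⇒walk j (inj₂ sc)   = edge (edge⇒adj j j (inSun sc))

  sun-walk : ∀ j s t → Walk (combine j s) (combine j t) 2
  sun-walk j s t with sun-centre s t
  ... | c , sc , tc = close⇒walk j sc ++ reverse (close⇒walk j tc)

  module _ (0<m : 0 < m) where

    first : Fin (m * 6)
    first = combine (fromℕ< 0<m) X

    walk-to-first : ∀ i (i<m : i < m) → Walk (combine (fromℕ< i<m) X) first (i * 3)
    walk-to-first zero    _     = []
    walk-to-first (suc i) i+1<m =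
      edge (edge⇒adj (fromℕ< i+1<m) (fromℕ< i<m) link) ++ (sun-walk (fromℕ< i<m) Y X ++ walk-to-first i i<m)
      where
        i<m : i < m
        i<m = ≤-trans (n≤1+n (suc i)) i+1<m
        link : ChainEdge (toℕ (fromℕ< i+1<m)) X (toℕ (fromℕ< i<m)) Y
        link = subst₂ (λ a b → ChainEdge a X b Y) (sym (toℕ-fromℕ< i+1<m)) (sym (toℕ-fromℕ< i<m)) leftLink

    vertex-to-first : ∀ j s → Walk (combine j s) first (2 + toℕ j * 3)
    vertex-to-first j s =
      sun-walk j s X ++ subst (λ i → Walk (combine i X) first (toℕ j * 3)) (fromℕ<-toℕ j (toℕ<n j))
                              (walk-to-first (toℕ j) (toℕ<n j))

    connected : Connected (sunChain m)
    connected u v = reachable (to-first u ++ reverse (to-first v))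
      where
        to-first : ∀ w → Walk w first (2 + toℕ (quotient {m} 6 w) * 3)
        to-first w = subst (λ x → Walk x first (2 + toℕ (quotient {m} 6 w) * 3)) (combine-remQuot {m} 6 w)
                           (vertex-to-first (quotient {m} 6 w) (kind m w))

  diameter≥5 : 2 ≤ m → ∀ D → IsDiam (sunChain m) D → 5 ≤ D
  diameter≥5 2≤m D (within , _) = apart (fromℕ< 0<m) (fromℕ< 2≤m) (toℕ-fromℕ< 0<m) (toℕ-fromℕ< 2≤m)
    where
      0<m : 0 < m
      0<m = ≤-trans (s≤s z≤n) 2≤m
      apart : ∀ (i₀ i₁ : Fin m) → toℕ i₀ ≡ 0 → toℕ i₁ ≡ 1 → 5 ≤ D
      apart i₀ i₁ e₀ e₁ with walk≥chainDist (dist⇒walk (combine i₀ Z) (combine i₁ Z) D (within _ _))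
      ... | bound rewrite sunIndex-combine i₀ Z | kind-combine i₀ Z | sunIndex-combine i₁ Z | kind-combine i₁ Z
                        | e₀ | e₁ = bound

  ballWeight≤bound : ∀ W v r → ballWeight (W ∘ kind m) v r ≤ ballWeightBound W (kind m v) r
  ballWeight≤bound W v r = begin
    ballWeight (W ∘ kind m) v r                                  ≤⟨ ∑-mono-≤ walk-bound ⟩
    sum within                                                   ≡⟨ ∑-combine m 6 within ⟩
    ∑[ j < m ] (∑[ s < 6 ] within (combine j s))                 ≡⟨ sum-cong-≗ {m} (λ j → sum-cong-≗ {6} (within-combine j)) ⟩
    ∑[ j < m ] weightWithin W (λ s → chainDist (toℕ j) s i t) r  ≤⟨ suns-bound W t r m i ⟩
    ∑[ d < i ] leftSun W t r (toℕ d) + notLeft W t r             ≤⟨ +-monoˡ-≤ _ (ray-bound W (leftProfile W t) i r) ⟩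
    ballWeightBound W t r                                        ∎
    where
      open ≤-Reasoning
      i = sunIndex m v
      t = kind m v

      within : Fin (m * 6) → ℕ
      within u = if chainDist (sunIndex m u) (kind m u) i t ≤ᵇ r then W (kind m u) else 0

      within-combine : ∀ j s → within (combine j s) ≡ (if chainDist (toℕ j) s i t ≤ᵇ r then W s else 0)
      within-combine j s =
        cong₂ (λ a b → if chainDist a b i t ≤ᵇ r then W b else 0) (sunIndex-combine j s) (kind-combine j s)

      walk-bound : ∀ u → (if reach (sunChain m) u v r then W (kind m u) else 0) ≤ within u
      walk-bound u with reach (sunChain m) u v r in reached
      ... | false = z≤n
      ... | true rewrite Equivalence.to T-≡ (≤⇒≤ᵇ (walk≥chainDist (dist⇒walk u v r (subst T (sym reached) tt))))
                  = ≤-refl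

  ballWeight-linear : ∀ W c → (∀ t (r : Fin 4) → ballWeightBound W t (suc (toℕ r)) ≤ c * suc (toℕ r)) →
                      2 * sum W ≤ 3 * c → ∀ v r → 1 ≤ r → ballWeight (W ∘ kind m) v r ≤ c * r
  ballWeight-linear W c small per-sun v r 1≤r =
    ≤-trans (ballWeight≤bound W v r) (ballWeightBound-linear W c small per-sun (kind m v) r 1≤r)

  ∑-kind : ∀ W → ∑[ u < m * 6 ] W (kind m u) ≡ m * sum W
  ∑-kind W = begin
    ∑[ u < m * 6 ] W (kind m u)                       ≡⟨ ∑-combine m 6 (W ∘ kind m) ⟩
    ∑[ j < m ] (∑[ s < 6 ] W (kind m (combine j s)))  ≡⟨ sum-cong-≗ {m} (λ j → sum-cong-≗ {6} (cong W ∘ kind-combine j)) ⟩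
    ∑[ j < m ] sum W                                  ≡⟨ ∑-const m (sum W) ⟩
    m * sum W                                         ∎
    where open ≡-Reasoning

  zSet : Subset (m * 6)
  zSet = tabulate (λ u → ⌊ kind m u ≟ Z ⌋)

  zSet-size : ∣ zSet ∣ ≡ m
  zSet-size = begin
    ∣ zSet ∣                                 ≡⟨ ∣∣≡∑ zSet ⟩
    ∑[ u < m * 6 ] indicator (lookup zSet u)  ≡⟨ sum-cong-≗ {m * 6} (cong indicator ∘ lookup∘tabulate _) ⟩
    ∑[ u < m * 6 ] zWeight (kind m u)         ≡⟨ ∑-kind zWeight ⟩
    m * 1                                    ≡⟨ *-identityʳ m ⟩
    m                                        ∎
    where open ≡-Reasoning

  zSet-multipacking : IsMultipacking (sunChain m) zSet
  zSet-multipacking v r 1≤r = begin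
    ∣ ball (sunChain m) v r ∩ zSet ∣           ≡⟨ ∣ball∩∣≡ballWeight zSet v r ⟩
    ballWeight (indicator ∘ lookup zSet) v r  ≡⟨ sum-cong-≗ {m * 6} (λ u → cong (if-reach u) (lookup∘tabulate _ u)) ⟩
    ballWeight (zWeight ∘ kind m) v r         ≤⟨ ballWeight-linear zWeight 1 small (s≤s (s≤s z≤n)) v r 1≤r ⟩
    1 * r                                     ≡⟨ ℕₚ.*-identityˡ r ⟩
    r                                         ∎
    where
      open ≤-Reasoning
      if-reach : Fin (m * 6) → Bool → ℕ
      if-reach u b = if reach (sunChain m) u v r then indicator b else 0
      small = from-yes (all? λ t → all? λ (r : Fin 4) →
        ballWeightBound zWeight t (suc (toℕ r)) ℕₚ.≤? 1 * suc (toℕ r))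

  multipacking≤suns : ∀ M → IsMultipacking (sunChain m) M → ∣ M ∣ ≤ m
  multipacking≤suns M packing = begin
    ∣ M ∣                                                       ≡⟨ ∣∣≡∑ M ⟩
    ∑[ u < m * 6 ] indicator (lookup M u)                       ≡⟨ ∑-combine m 6 _ ⟩
    ∑[ j < m ] (∑[ s < 6 ] indicator (lookup M (combine j s)))  ≤⟨ ∑-mono-≤ (λ j → ∑-indicator≤1 _ (one-per-sun j)) ⟩
    ∑[ j < m ] 1                                                ≡⟨ ∑-const m 1 ⟩
    m * 1                                                       ≡⟨ *-identityʳ m ⟩
    m                                                           ∎
    where
      open ≤-Reasoning
      one-per-sun : ∀ j {s s′} → T (lookup M (combine j s)) → T (lookup M (combine j s′)) → s ≡ s′
      one-per-sun j {s} {s′} Ms Ms′ with sun-centre s s′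
      ... | c , sc , s′c =
        combine-injectiveʳ j s j s′ (multipacking-unique packing (close⇒walk j sc) (close⇒walk j s′c) Ms Ms′)

  multipacking-number : MultipackingNumber (sunChain m) m
  multipacking-number = (zSet , zSet-multipacking , zSet-size) , multipacking≤suns

  cost≥ : ∀ f → IsDomBroadcast (sunChain m) f → m * 4 ≤ 3 * cost (sunChain m) f
  cost≥ f (_ , dominating) = begin
    m * 4                        ≡⟨ sym (∑-kind dualWeight) ⟩
    sum (dualWeight ∘ kind m)    ≤⟨ dominating-cost-bound (dualWeight ∘ kind m) 3 ball-bound f dominating ⟩
    3 * cost (sunChain m) f      ∎
    where
      open ≤-Reasoning
      ball-bound = ballWeight-linear dualWeight 3
        (from-yes (all? λ t → all? λ (r : Fin 4) →
           ballWeightBound dualWeight t (suc (toℕ r)) ℕₚ.≤? 3 * suc (toℕ r)))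
        (n≤1+n 8)

-- Power 4 on the B of the middle sun of every block of three consecutive suns.
power : Fin 3 → Fin 6 → ℕ
power (suc zero) B = 4
power _          _ = 0

power≤4 : ∀ p s → power p s ≤ 4
power≤4 = from-yes (all? λ p → all? λ s → power p s ℕₚ.≤? 4)

toℕ-combine-suc : ∀ {k n} (g : Fin k) (p : Fin n) → toℕ (combine g (suc p)) ≡ suc (toℕ (combine g (inject₁ p)))
toℕ-combine-suc {n = n} g p = begin
  toℕ (combine g (suc p))                ≡⟨ toℕ-combine g (suc p) ⟩
  suc n * toℕ g + suc (toℕ p)            ≡⟨ +-suc _ (toℕ p) ⟩
  suc (suc n * toℕ g + toℕ p)            ≡⟨ cong (λ x → suc (suc n * toℕ g + x)) (sym (toℕ-inject₁ p)) ⟩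
  suc (suc n * toℕ g + toℕ (inject₁ p))  ≡⟨ cong suc (sym (toℕ-combine g (inject₁ p))) ⟩
  suc (toℕ (combine g (inject₁ p)))      ∎
  where open ≡-Reasoning

module Broadcast (k : ℕ) where
  open SunChain (k * 3)

  broadcast : Fin (k * 3 * 6) → ℕ
  broadcast u = power (remainder {k} 3 (quotient {k * 3} 6 u)) (kind (k * 3) u)

  broadcast-combine : ∀ (g : Fin k) (p : Fin 3) (s : Fin 6) → broadcast (combine (combine g p) s) ≡ power p s
  broadcast-combine g p s =
    cong₂ power (trans (cong (remainder {k} 3 ∘ proj₁) (remQuot-combine (combine g p) s))
                       (cong proj₂ (remQuot-combine g p)))
                (kind-combine (combine g p) s)

  broadcast-cost : cost (sunChain (k * 3)) broadcast ≡ k * 4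
  broadcast-cost = begin
    cost (sunChain (k * 3)) broadcast                                        ≡⟨ cost≡∑ broadcast ⟩
    sum broadcast                                                            ≡⟨ ∑-combine (k * 3) 6 broadcast ⟩
    ∑[ j < k * 3 ] (∑[ s < 6 ] broadcast (combine j s))                       ≡⟨ ∑-combine k 3 _ ⟩
    ∑[ g < k ] (∑[ p < 3 ] (∑[ s < 6 ] broadcast (combine (combine g p) s)))  ≡⟨ sum-cong-≗ {k} block-cost ⟩
    ∑[ g < k ] 4                                                             ≡⟨ ∑-const k 4 ⟩
    k * 4                                                                    ∎
    where
      open ≡-Reasoning
      block-cost : ∀ g → ∑[ p < 3 ] (∑[ s < 6 ] broadcast (combine (combine g p) s)) ≡ 4
      block-cost g = sum-cong-≗ {3} λ p → sum-cong-≗ {6} (broadcast-combine g p)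

  centre : Fin k → Fin (k * 3 * 6)
  centre g = combine (combine g (suc zero)) B

  covered : ∀ (g : Fin k) p s → Walk (combine (combine g p) s) (centre g) 4
  covered g zero s =
    sun-walk left s Y ++ (edge (edge⇒adj left middle link) ++ edge (edge⇒adj middle middle (inSun tt)))
    where
      left middle : Fin (k * 3)
      left   = combine g zero
      middle = combine g (suc zero)
      link : ChainEdge (toℕ left) Y (toℕ middle) X
      link = subst (λ a → ChainEdge (toℕ left) Y a X) (sym (toℕ-combine-suc g zero)) rightLink
  covered g (suc zero) s = walk-mono (s≤s (s≤s z≤n)) (sun-walk (combine g (suc zero)) s B)
  covered g (suc (suc zero)) s =
    sun-walk right s X ++ (edge (edge⇒adj right middle link) ++ edge (edge⇒adj middle middle (inSun tt)))
    where
      right middle : Fin (k * 3)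
      right  = combine g (suc (suc zero))
      middle = combine g (suc zero)
      link : ChainEdge (toℕ right) X (toℕ middle) Y
      link = subst (λ a → ChainEdge a X (toℕ middle) Y) (sym (toℕ-combine-suc g (suc zero))) leftLink

  dominating : IsDominating (sunChain (k * 3)) broadcast
  dominating u = centre g , subst (0 <_) (sym centre-power) (s≤s z≤n) ,
    walk⇒dist (subst₂ (λ x r → Walk x (centre g) r) u-decomposed (sym centre-power) (covered g p (kind (k * 3) u)))
    where
      j = quotient {k * 3} 6 u
      g = quotient {k} 3 j
      p = remainder {k} 3 j
      centre-power : broadcast (centre g) ≡ 4
      centre-power = broadcast-combine g (suc zero) B
      u-decomposed : combine (combine g p) (kind (k * 3) u) ≡ u
      u-decomposed =
        trans (cong (λ i → combine i (kind (k * 3) u)) (combine-remQuot {k} 3 j)) (combine-remQuot {k * 3} 6 u)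

  broadcast≤diameter : 2 ≤ k * 3 → IsBroadcast (sunChain (k * 3)) broadcast
  broadcast≤diameter 2≤m D diameter v =
    ≤-trans (power≤4 _ (kind (k * 3) v)) (≤-trans (n≤1+n 4) (diameter≥5 2≤m D diameter))

  optimal : ∀ f → IsDomBroadcast (sunChain (k * 3)) f → k * 4 ≤ cost (sunChain (k * 3)) f
  optimal f dom = ℕₚ.*-cancelˡ-≤ 3 (subst (_≤ 3 * cost (sunChain (k * 3)) f) (regroup k) (cost≥ f dom))
    where
      regroup : ∀ k → k * 3 * 4 ≡ 3 * (k * 4)
      regroup = solve-∀

  broadcast-number : 2 ≤ k * 3 → BroadcastDomNumber (sunChain (k * 3)) (k * 4)
  broadcast-number 2≤m = (broadcast , (broadcast≤diameter 2≤m , dominating) , broadcast-cost) , optimal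

mainTheorem8 : ∀ (k : ℕ) → 1 ≤ k →
    ∃ λ (F : Graph) →
      Connected F × Chordal F ×
      MultipackingNumber F (3 * k) × BroadcastDomNumber F (4 * k)
mainTheorem8 k@(suc _) _ =
  sunChain (k * 3) , connected (s≤s z≤n) , chordal ,
  subst (MultipackingNumber (sunChain (k * 3))) (*-comm k 3) multipacking-number ,
  subst (BroadcastDomNumber (sunChain (k * 3))) (*-comm k 4) (broadcast-number (s≤s (s≤s z≤n)))
  where
    open SunChain (k * 3)
    open Broadcast k
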